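{- Let $\Sigma$ be a signed graph such that $\Sigma{:}E^-$ is bipartite, with connected components $C_1,\dots,C_m$, and for each $i$ let $\{V_{i1},V_{i2}\}$ be the unique stable bipartition of $C_i$. Let $\Phi_0$ be the signed graph with vertex set $\{V_{i1},V_{i2}\}_{i=1}^m$ (each $V_{i\alpha}$ treated as a single vertex) and negative edge set $\{(V_{i1},V_{i2})\}_{i=1}^m$. Let $S$ be a set of positive edges on $V(\Phi_0)$ and let $\Phi:=\Phi_0\cup S$. Then $\Phi$ is balanced if and only if there exists a stable bipartition $\{B_1,B_2\}$ of $\Sigma{:}E^-$ such that for all $V_{i\alpha},V_{j\beta}\in V(\Phi)$: (1) $V_{i\alpha}$ and $V_{j\beta}$ are contained in the same class of $\{B_1,B_2\}$ if there exists a positive path from $V_{i\alpha}$ to $V_{j\beta}$ in $\Phi$; (2) $V_{i\alpha}$ and $V_{j\beta}$ are contained in opposite classes of $\{B_1,B_2\}$ if there exists a negative path from $V_{i\alpha}$ to $V_{j\beta}$ in $\Phi$.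
   Context: A signed graph is a pair $(\Gamma,\sigma)$ with $\sigma: E(\Gamma)\to\{+,-\}$ (here $\Phi$ may have a positive and a negative edge between the same two vertices). The sign of a path or circle is the product of the signs of its edges; a signed graph is balanced if every circle is positive. $\Sigma{:}E^-$ is the subgraph of $\Sigma$ consisting of the negative edges and their endpoints. A stable bipartition of a graph is a bipartition of its vertex set into two classes each containing no edge of that graph. -}

module Defs where

open import Data.Nat using (ℕ; zero; suc; _+_; _≤_)
open import Data.Fin using (Fin; splitAt) renaming (zero to fzero; suc to fsuc)
open import Data.Bool using (Bool; true; false; not)
open import Data.Product using (Σ; _×_; _,_; proj₁; proj₂; ∃)
open import Data.Sum using (_⊎_; inj₁; inj₂; [_,_])
open import Data.List using (List; []; _∷_; length)
open import Data.List.Relation.Unary.All using (All)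
open import Data.List.Relation.Unary.Unique.Propositional using (Unique)
open import Relation.Binary.PropositionalEquality using (_≡_; _≢_)
open import Relation.Nullary using (¬_)
open import Function.Bundles using (_⇔_)

data Sign : Set where
  plus minus : Sign

_·_ : Sign → Sign → Sign
plus  · s = s
minus · plus = minus
minus · minus = plus

-- Signed (multi)graphs: vertex type V, finitely many edges indexed by
-- Fin nE, each with two endpoints and a sign.  Parallel edges (even of
-- opposite signs) and loops are allowed.

record SignedGraph (V : Set) : Set where
  field
    nE   : ℕ
    ends : Fin nE → V × V
    sgn  : Fin nE → Sign

  src tgt : Fin nE → V
  src e = proj₁ (ends e)
  tgt e = proj₂ (ends e)

open SignedGraph public

module _ {V : Set} (G : SignedGraph V) where

  Joins : Fin (nE G) → V → V → Set
  Joins e u w = (src G e ≡ u × tgt G e ≡ w) ⊎ (src G e ≡ w × tgt G e ≡ u)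

  data Walk : V → V → Set where
    []   : ∀ {v} → Walk v v
    step : ∀ {u w v} (e : Fin (nE G)) → Joins e u w → Walk w v → Walk u v

  walkSign : ∀ {u v} → Walk u v → Sign
  walkSign []           = plus
  walkSign (step e _ p) = sgn G e · walkSign p

  verts : ∀ {u v} → Walk u v → List V
  verts {u} []             = u ∷ []
  verts {u} (step e _ p)   = u ∷ verts p

  edgesOf : ∀ {u v} → Walk u v → List (Fin (nE G))
  edgesOf []           = []
  edgesOf (step e _ p) = e ∷ edgesOf p

  IsPath : ∀ {u v} → Walk u v → Set
  IsPath p = Unique (verts p)

  -- a circle: a closed walk of length ≥ 1 with pairwise distinct edges
  -- and whose vertices v₁,…,vₗ (= v₀) are pairwise distinct
  tailVerts : ∀ {u v} → Walk u v → List V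
  tailVerts []           = []
  tailVerts (step e _ p) = verts p

  IsCircle : ∀ {v} → Walk v v → Set
  IsCircle p = (1 ≤ length (edgesOf p)) × Unique (tailVerts p) × Unique (edgesOf p)

  Balanced : Set
  Balanced = ∀ {v} (p : Walk v v) → IsCircle p → walkSign p ≡ plus

  PosPath NegPath : V → V → Set
  PosPath u v = Σ (Walk u v) λ p → IsPath p × walkSign p ≡ plus
  NegPath u v = Σ (Walk u v) λ p → IsPath p × walkSign p ≡ minus

  InNeg : V → Set
  InNeg v = Σ (Fin (nE G)) λ e → sgn G e ≡ minus × (src G e ≡ v ⊎ tgt G e ≡ v)

  NegConnected : V → V → Set
  NegConnected u v = Σ (Walk u v) λ p → All (λ e → sgn G e ≡ minus) (edgesOf p)

  -- B : V → Bool describes the bipartition {B⁻¹ true, B⁻¹ false} of V(G:E⁻)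
  -- (values of B off V(G:E⁻) are irrelevant); stable = no edge of G:E⁻
  -- inside a class
  StableBipNeg : (V → Bool) → Set
  StableBipNeg B = ∀ e → sgn G e ≡ minus → B (src G e) ≢ B (tgt G e)

  -- comp labels the connected components C₁,…,Cₘ of G:E⁻ (bijectively:
  -- every label is used, and two vertices of G:E⁻ get the same label iff
  -- they are connected in G:E⁻)
  IsComponentLabelling : {m : ℕ} → (V → Fin m) → Set
  IsComponentLabelling {m} comp =
    (∀ i → Σ V λ v → InNeg v × comp v ≡ i) ×
    (∀ u v → InNeg u → InNeg v → (comp u ≡ comp v ⇔ NegConnected u v))

-- The contracted graph Φ = Φ₀ ∪ S.
-- Vertex (i , α) stands for V_{iα}, α ∈ Fin 2.

PhiV : ℕ → Set
PhiV m = Fin m × Fin 2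

module _ {m : ℕ} where
  private
    z o : Fin 2
    z = fzero
    o = fsuc fzero

  -- Φ₀'s negative edges (V_{i1},V_{i2}), then the k positive edges of S
  Phi : (k : ℕ) → (Fin k → PhiV m × PhiV m) → SignedGraph (PhiV m)
  Phi k S = record
    { nE   = m + k
    ; ends = λ e → [ (λ i → (i , z) , (i , o)) , S ] (splitAt m e)
    ; sgn  = λ e → [ (λ _ → minus) , (λ _ → plus) ] (splitAt m e)
    }

module _ {n m : ℕ} (Sg : SignedGraph (Fin n)) (comp : Fin n → Fin m) (side : Fin n → Fin 2) where

  InPart : PhiV m → Fin n → Set
  InPart (i , α) v = InNeg Sg v × comp v ≡ i × side v ≡ α

  InClass : (Fin n → Bool) → PhiV m → Bool → Set
  InClass B x c = ∀ v → InPart x v → B v ≡ c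

  SameClass OppClass : (Fin n → Bool) → PhiV m → PhiV m → Set
  SameClass B x y = Σ Bool λ c → InClass B x c × InClass B y c
  OppClass  B x y = Σ Bool λ c → InClass B x c × InClass B y (not c)

module Submission where

-- Both sides are equivalent to Φ being switchable, i.e. having f : V(Φ) → {+,-} with
-- σ(e) = f(u) f(w) for every edge uw.  This is Harary's theorem for Balanced; the sign of any
-- walk from u to v is then f(u) f(v).  From f, colour each vertex of Σ:E⁻ by f of its part;
-- from B, set f(V_{iα}) to the colour of any vertex of V_{iα} (parts are non-empty, as each
-- component contains a negative edge whose ends lie on opposite sides).  Harary's theorem is
-- proved by building f one edge at a time, merging the classes of its ends; an edge inside one
-- class is consistent because in a balanced graph every closed walk, shortcut to circles, is
-- positive.

open import Defs
open import Data.Nat using (ℕ; s≤s; z≤n)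
open import Data.Fin using (Fin; _↑ˡ_; splitAt) renaming (zero to fzero; suc to fsuc)
open import Data.Fin.Properties using (splitAt-↑ˡ) renaming (_≟_ to _≟ᶠ_)
open import Data.Bool using (Bool; true; false; not)
open import Data.Bool.Properties using (not-¬)
open import Data.Product using (Σ; ∃; _×_; _,_; proj₁; proj₂)
open import Data.Product.Properties using (≡-dec)
import Data.Product as Product
open import Data.Sum using (_⊎_; inj₁; inj₂)
open import Data.List using (List; []; _∷_; allFin)
open import Data.List.Relation.Unary.All as All using (All; []; _∷_)
open import Data.List.Relation.Unary.All.Properties using (anti-mono)
open import Data.List.Relation.Unary.All.Properties.Core using (¬Any⇒All¬; All¬⇒¬Any)
open import Data.List.Relation.Unary.Any using (here; there)
open import Data.List.Relation.Unary.AllPairs using ([]; _∷_)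
open import Data.List.Relation.Unary.Unique.Propositional using (Unique)
open import Data.List.Relation.Binary.Subset.Propositional using (_⊆_)
open import Data.List.Membership.Propositional using (_∈_; _∉_)
open import Data.List.Membership.Propositional.Properties using (∈-allFin)
open import Data.Empty using (⊥-elim)
open import Relation.Nullary using (Dec; yes; no)
open import Relation.Binary.Definitions using (DecidableEquality)
open import Relation.Binary.PropositionalEquality
  using (_≡_; _≢_; refl; sym; trans; cong; cong₂; subst; module ≡-Reasoning)
open import Function.Base using (_∘_)
open import Function.Bundles using (_⇔_; mk⇔; Equivalence)

open ≡-Reasoning

·-identityʳ : ∀ s → s · plus ≡ s
·-identityʳ plus  = refl
·-identityʳ minus = refl

·-comm : ∀ s t → s · t ≡ t · s
·-comm plus  plus  = refl
·-comm plus  minus = refl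
·-comm minus plus  = refl
·-comm minus minus = refl

·-assoc : ∀ s t u → (s · t) · u ≡ s · (t · u)
·-assoc plus  t     u     = refl
·-assoc minus plus  u     = refl
·-assoc minus minus plus  = refl
·-assoc minus minus minus = refl

·-selfInverse : ∀ s → s · s ≡ plus
·-selfInverse plus  = refl
·-selfInverse minus = refl

·-cancelˡ : ∀ s t → s · (s · t) ≡ t
·-cancelˡ s t = trans (sym (·-assoc s s t)) (cong (_· t) (·-selfInverse s))

·-cancel-common : ∀ s t u → (s · u) · (t · u) ≡ s · t
·-cancel-common plus  plus  plus  = refl
·-cancel-common plus  plus  minus = refl
·-cancel-common plus  minus plus  = refl
·-cancel-common plus  minus minus = refl
·-cancel-common minus plus  plus  = refl
·-cancel-common minus plus  minus = refl
·-cancel-common minus minus plus  = refl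
·-cancel-common minus minus minus = refl

·≡plus⇒≡ : ∀ {s t} → s · t ≡ plus → s ≡ t
·≡plus⇒≡ {plus}  {plus}  _ = refl
·≡plus⇒≡ {minus} {minus} _ = refl

isMinus : Sign → Bool
isMinus plus  = false
isMinus minus = true

isMinus-·≡minus : ∀ {s t} → s · t ≡ minus → isMinus t ≡ not (isMinus s)
isMinus-·≡minus {plus}  {minus} _ = refl
isMinus-·≡minus {minus} {plus}  _ = refl

fromBool : Bool → Sign
fromBool false = plus
fromBool true  = minus

fromBool-not : ∀ b → fromBool b · fromBool (not b) ≡ minus
fromBool-not false = refl
fromBool-not true  = refl

module _ {V : Set} (G : SignedGraph V) where

  infixr 5 _++ʷ_

  _++ʷ_ : ∀ {u v w} → Walk G u v → Walk G v w → Walk G u w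
  []           ++ʷ q = q
  step e J p   ++ʷ q = step e J (p ++ʷ q)

  walkSign-++ : ∀ {u v w} (p : Walk G u v) (q : Walk G v w) →
                walkSign G (p ++ʷ q) ≡ walkSign G p · walkSign G q
  walkSign-++ []           q = refl
  walkSign-++ (step e J p) q =
    trans (cong (sgn G e ·_) (walkSign-++ p q)) (sym (·-assoc (sgn G e) _ _))

  Joins-sym : ∀ {e u w} → Joins G e u w → Joins G e w u
  Joins-sym (inj₁ ends) = inj₂ ends
  Joins-sym (inj₂ ends) = inj₁ ends

  Joins-ends : ∀ {e a b u w} → Joins G e a b → Joins G e u w → (a ≡ u × b ≡ w) ⊎ (a ≡ w × b ≡ u)
  Joins-ends (inj₁ (refl , refl)) (inj₁ (s , t)) = inj₁ (s , t)
  Joins-ends (inj₁ (refl , refl)) (inj₂ (s , t)) = inj₂ (s , t)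
  Joins-ends (inj₂ (refl , refl)) (inj₁ (s , t)) = inj₂ (t , s)
  Joins-ends (inj₂ (refl , refl)) (inj₂ (s , t)) = inj₁ (t , s)

  Joins-retrace : ∀ {e u w h} → Joins G e u w → Joins G e w h → h ≡ u
  Joins-retrace J J′ with Joins-ends J′ (Joins-sym J)
  ... | inj₁ (_ , h≡u)     = h≡u
  ... | inj₂ (w≡u , h≡w)   = trans h≡w w≡u

  reverseʷ : ∀ {u v} → Walk G u v → Walk G v u
  reverseʷ []           = []
  reverseʷ (step e J p) = reverseʷ p ++ʷ step e (Joins-sym J) []

  walkSign-reverse : ∀ {u v} (p : Walk G u v) → walkSign G (reverseʷ p) ≡ walkSign G p
  walkSign-reverse []           = refl
  walkSign-reverse (step e J p) = begin
    walkSign G (reverseʷ p ++ʷ step e (Joins-sym J) [])  ≡⟨ walkSign-++ (reverseʷ p) _ ⟩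
    walkSign G (reverseʷ p) · (sgn G e · plus)          ≡⟨ cong₂ _·_ (walkSign-reverse p) (·-identityʳ (sgn G e)) ⟩
    walkSign G p · sgn G e                              ≡⟨ ·-comm (walkSign G p) (sgn G e) ⟩
    sgn G e · walkSign G p                              ∎

  SignedWalk : V → V → Sign → Set
  SignedWalk u v s = Σ (Walk G u v) λ p → walkSign G p ≡ s

  infixr 5 _⊕_

  _⊕_ : ∀ {u v w s t} → SignedWalk u v s → SignedWalk v w t → SignedWalk u w (s · t)
  (p , refl) ⊕ (q , refl) = p ++ʷ q , walkSign-++ p q

  reverseˢ : ∀ {u v s} → SignedWalk u v s → SignedWalk v u s
  reverseˢ (p , refl) = reverseʷ p , walkSign-reverse p

  stepˢ : ∀ {u w v s} e → Joins G e u w → SignedWalk w v s → SignedWalk u v (sgn G e · s)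
  stepˢ e J (p , refl) = step e J p , refl

  Switching : (V → Sign) → Set
  Switching f = ∀ e → sgn G e ≡ f (src G e) · f (tgt G e)

  module _ {f : V → Sign} (switching : Switching f) where

    switching-Joins : ∀ {e u w} → Joins G e u w → sgn G e ≡ f u · f w
    switching-Joins {e} (inj₁ (refl , refl)) = switching e
    switching-Joins {e} (inj₂ (refl , refl)) = trans (switching e) (·-comm (f (src G e)) (f (tgt G e)))

    walkSign-switching : ∀ {u v} (p : Walk G u v) → walkSign G p ≡ f u · f v
    walkSign-switching {u} [] = sym (·-selfInverse (f u))
    walkSign-switching {u} {v} (step {w = w} e J p) = begin
      sgn G e · walkSign G p    ≡⟨ cong₂ _·_ (switching-Joins J) (walkSign-switching p) ⟩
      (f u · f w) · (f w · f v) ≡⟨ ·-assoc (f u) (f w) _ ⟩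
      f u · (f w · (f w · f v)) ≡⟨ cong (f u ·_) (·-cancelˡ (f w) (f v)) ⟩
      f u · f v                 ∎

    switching⇒balanced : Balanced G
    switching⇒balanced {v} p _ = trans (walkSign-switching p) (·-selfInverse (f v))

  head∈verts : ∀ {u v} (p : Walk G u v) → u ∈ verts G p
  head∈verts []           = here refl
  head∈verts (step e J p) = here refl

  last∈verts : ∀ {u v} (p : Walk G u v) → v ∈ verts G p
  last∈verts []           = here refl
  last∈verts (step e J p) = there (last∈verts p)

  closedPath-positive : ∀ {u} (p : Walk G u u) → IsPath G p → walkSign G p ≡ plus
  closedPath-positive []           _          = refl
  closedPath-positive (step e J p) (u∉p ∷ _) = ⊥-elim (All¬⇒¬Any u∉p (last∈verts p))

  ends∈verts : ∀ {e a b u v} (q : Walk G u v) → e ∈ edgesOf G q → Joins G e a b →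
               a ∈ verts G q × b ∈ verts G q
  ends∈verts (step e J q) (here refl) J′ with Joins-ends J′ J
  ... | inj₁ (refl , refl) = here refl , there (head∈verts q)
  ... | inj₂ (refl , refl) = there (head∈verts q) , here refl
  ends∈verts (step e J q) (there e∈q) J′ = Product.map there there (ends∈verts q e∈q J′)

  path⇒edges-unique : ∀ {u v} (p : Walk G u v) → IsPath G p → Unique (edgesOf G p)
  path⇒edges-unique []           _          = []
  path⇒edges-unique (step e J p) (u∉p ∷ up) =
    ¬Any⇒All¬ _ (λ e∈p → All¬⇒¬Any u∉p (proj₁ (ends∈verts p e∈p J))) ∷ path⇒edges-unique p up

  splitPath : ∀ {u w v} (q : Walk G w v) → IsPath G q → u ∈ verts G q →
    Σ (Walk G w u) λ q₁ → Σ (Walk G u v) λ q₂ →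
      verts G q₁ ⊆ verts G q × IsPath G q₁ × IsPath G q₂ ×
      walkSign G q ≡ walkSign G q₁ · walkSign G q₂
  splitPath []           uq (here refl) = [] , [] , (λ x → x) , uq , uq , refl
  splitPath (step e J q) uq (here refl) =
    [] , step e J q , (λ { (here refl) → here refl }) , [] ∷ [] , uq , refl
  splitPath (step e J q) (w∉q ∷ uq) (there u∈q) with splitPath q uq u∈q
  ... | q₁ , q₂ , q₁⊆q , uq₁ , uq₂ , q≈ =
    step e J q₁ , q₂ ,
    (λ { (here refl) → here refl ; (there x∈q₁) → there (q₁⊆q x∈q₁) }) ,
    anti-mono q₁⊆q w∉q ∷ uq₁ , uq₂ ,
    trans (cong (sgn G e ·_) q≈) (sym (·-assoc (sgn G e) _ _))

  module _ (balanced : Balanced G) where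

    -- An edge closed up by a path is a circle, except when the path starts by retracing the edge.
    stepPath-positive : ∀ {u w} e (J : Joins G e u w) (q : Walk G w u) → IsPath G q →
                        walkSign G (step e J q) ≡ plus
    stepPath-positive e J [] _ = balanced (step e J []) (s≤s z≤n , [] ∷ [] , [] ∷ [])
    stepPath-positive e J (step e′ J′ q) uq@(w∉q ∷ uq′) with e ≟ᶠ e′
    ... | no e≢e′ =
      balanced (step e J (step e′ J′ q))
        (s≤s z≤n , uq , (e≢e′ ∷ ¬Any⇒All¬ _ e∉q) ∷ path⇒edges-unique (step e′ J′ q) uq)
      where
        e∉q : e ∉ edgesOf G q
        e∉q e∈q = All¬⇒¬Any w∉q (proj₂ (ends∈verts q e∈q J))
    ... | yes refl with Joins-retrace J J′
    ...   | refl = trans (·-cancelˡ (sgn G e) (walkSign G q)) (closedPath-positive q uq′)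

    module _ (_≟_ : DecidableEquality V) where
      open import Data.List.Membership.DecPropositional _≟_ using (_∈?_)

      walk⇒path : ∀ {u v} (p : Walk G u v) →
                  Σ (Walk G u v) λ q → IsPath G q × walkSign G q ≡ walkSign G p
      walk⇒path [] = [] , [] ∷ [] , refl
      walk⇒path {u} (step e J p) with walk⇒path p
      ... | q , uq , q≈p with u ∈? verts G q
      ...   | no u∉q = step e J q , ¬Any⇒All¬ _ u∉q ∷ uq , cong (sgn G e ·_) q≈p
      ...   | yes u∈q with splitPath q uq u∈q
      ...     | q₁ , q₂ , _ , uq₁ , uq₂ , q≈q₁q₂ = q₂ , uq₂ , (begin
        walkSign G q₂                             ≡⟨ cong (_· walkSign G q₂) (stepPath-positive e J q₁ uq₁) ⟨
        (sgn G e · walkSign G q₁) · walkSign G q₂ ≡⟨ ·-assoc (sgn G e) _ _ ⟩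
        sgn G e · (walkSign G q₁ · walkSign G q₂) ≡⟨ cong (sgn G e ·_) (trans (sym q≈q₁q₂) q≈p) ⟩
        sgn G e · walkSign G p                    ∎)

      closedWalk-positive : ∀ {u} (p : Walk G u u) → walkSign G p ≡ plus
      closedWalk-positive p with walk⇒path p
      ... | q , uq , q≈p = trans (sym q≈p) (closedPath-positive q uq)

      sgn-via-walks : ∀ {e x y r r′} → Joins G e x y → (px : Walk G x r) (py : Walk G y r′) → r ≡ r′ →
                      sgn G e ≡ walkSign G px · walkSign G py
      sgn-via-walks {e} J px py refl =
        trans (·≡plus⇒≡ closed) (·-comm (walkSign G py) (walkSign G px))
        where
          closed : sgn G e · (walkSign G py · walkSign G px) ≡ plus
          closed = begin
            sgn G e · (walkSign G py · walkSign G px)             ≡⟨ cong (λ s → sgn G e · (walkSign G py · s)) (walkSign-reverse px) ⟨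
            sgn G e · (walkSign G py · walkSign G (reverseʷ px))  ≡⟨ cong (sgn G e ·_) (walkSign-++ py (reverseʷ px)) ⟨
            walkSign G (step e J (py ++ʷ reverseʷ px))            ≡⟨ closedWalk-positive (step e J (py ++ʷ reverseʷ px)) ⟩
            plus                                                  ∎

      Fits : (V → V) → (V → Sign) → Fin (nE G) → Set
      Fits root parity e = root (src G e) ≡ root (tgt G e) × sgn G e ≡ parity (src G e) · parity (tgt G e)

      -- Union-find with parities, after processing the edges of L.
      record Potential (L : List (Fin (nE G))) : Set where
        field
          root   : V → V
          parity : V → Sign
          reach  : ∀ v → SignedWalk v (root v) (parity v)
          fits   : All (Fits root parity) L

      trivialPotential : Potential []
      trivialPotential = record
        { root = λ v → v ; parity = λ _ → plus ; reach = λ v → [] , refl ; fits = [] }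

      module Extend {L} (P : Potential L) (e : Fin (nE G)) where
        open Potential P

        x y : V
        x = src G e
        y = tgt G e

        sameRoot : root x ≡ root y → Potential (e ∷ L)
        sameRoot r = record
          { root = root ; parity = parity ; reach = reach
          ; fits = (r , edgeFits) ∷ fits }
          where
            edgeFits : sgn G e ≡ parity x · parity y
            edgeFits with reach x | reach y
            ... | px , px≈ | py , py≈ = trans (sgn-via-walks (inj₁ (refl , refl)) px py r) (cong₂ _·_ px≈ py≈)

        -- Re-root the class of y at root x, through the new edge.
        module Merge (distinct : root x ≢ root y) where

          shift : Sign
          shift = parity y · (sgn G e · parity x)

          bridge : SignedWalk (root y) (root x) shift
          bridge = reverseˢ (reach y) ⊕ stepˢ e (inj₂ (refl , refl)) (reach x)

          root′ : ∀ v → Dec (root v ≡ root y) → V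
          root′ v (yes _) = root x
          root′ v (no _)  = root v

          parity′ : ∀ v → Dec (root v ≡ root y) → Sign
          parity′ v (yes _) = parity v · shift
          parity′ v (no _)  = parity v

          reach′ : ∀ v d → SignedWalk v (root′ v d) (parity′ v d)
          reach′ v (yes r) = subst (λ r → SignedWalk v r (parity v)) r (reach v) ⊕ bridge
          reach′ v (no _)  = reach v

          fits-old : ∀ {e′} (d₁ : Dec (root (src G e′) ≡ root y)) (d₂ : Dec (root (tgt G e′) ≡ root y)) →
                     Fits root parity e′ →
                     root′ (src G e′) d₁ ≡ root′ (tgt G e′) d₂ × sgn G e′ ≡ parity′ (src G e′) d₁ · parity′ (tgt G e′) d₂
          fits-old {e′} (yes _) (yes _) (_ , s≡) =
            refl , trans s≡ (sym (·-cancel-common (parity (src G e′)) (parity (tgt G e′)) shift))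
          fits-old (yes r₁) (no ¬r₂) (r , _) = ⊥-elim (¬r₂ (trans (sym r) r₁))
          fits-old (no ¬r₁) (yes r₂) (r , _) = ⊥-elim (¬r₁ (trans r r₂))
          fits-old (no _)   (no _)   fit    = fit

          fits-new : (d₁ : Dec (root x ≡ root y)) (d₂ : Dec (root y ≡ root y)) →
                     root′ x d₁ ≡ root′ y d₂ × sgn G e ≡ parity′ x d₁ · parity′ y d₂
          fits-new (yes r) _       = ⊥-elim (distinct r)
          fits-new (no _)  (no ¬r) = ⊥-elim (¬r refl)
          fits-new (no _)  (yes _) = refl , sym (begin
            parity x · (parity y · (parity y · (sgn G e · parity x))) ≡⟨ cong (parity x ·_) (·-cancelˡ (parity y) _) ⟩
            parity x · (sgn G e · parity x)                          ≡⟨ cong (parity x ·_) (·-comm (sgn G e) (parity x)) ⟩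
            parity x · (parity x · sgn G e)                          ≡⟨ ·-cancelˡ (parity x) (sgn G e) ⟩
            sgn G e                                                  ∎)

          merged : Potential (e ∷ L)
          merged = record
            { root   = λ v → root′ v (root v ≟ root y)
            ; parity = λ v → parity′ v (root v ≟ root y)
            ; reach  = λ v → reach′ v (root v ≟ root y)
            ; fits   = fits-new (root x ≟ root y) (root y ≟ root y)
                     ∷ All.map (λ {e′} → fits-old (root (src G e′) ≟ root y) (root (tgt G e′) ≟ root y)) fits
            }

      extend : ∀ {L} → Potential L → ∀ e → Potential (e ∷ L)
      extend P e with Potential.root P (src G e) ≟ Potential.root P (tgt G e)
      ... | yes r = Extend.sameRoot P e r
      ... | no ¬r = Extend.Merge.merged P e ¬r

      potential : ∀ L → Potential L
      potential []      = trivialPotential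
      potential (e ∷ L) = extend (potential L) e

      balanced⇒switching : ∃ Switching
      balanced⇒switching =
        Potential.parity P , λ e → proj₂ (All.lookup (Potential.fits P) (∈-allFin e))
        where P = potential (allFin (nE G))

  balanced⇔switchable : DecidableEquality V → Balanced G ⇔ ∃ Switching
  balanced⇔switchable _≟_ =
    mk⇔ (λ balanced → balanced⇒switching (λ {v} → balanced {v}) _≟_) (λ (f , sw) {v} → switching⇒balanced {f} sw {v})

PhiV-≟ : ∀ {m} → DecidableEquality (PhiV m)
PhiV-≟ = ≡-dec _≟ᶠ_ _≟ᶠ_

module _ {m k : ℕ} (S : Fin k → PhiV m × PhiV m) where

  Phi-loop-positive : ∀ e → src (Phi k S) e ≡ tgt (Phi k S) e → sgn (Phi k S) e ≡ plus
  Phi-loop-positive e loop with splitAt m e | loop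
  ... | inj₁ i | ()
  ... | inj₂ j | _ = refl

  rung-sign : ∀ i → sgn (Phi k S) (i ↑ˡ k) ≡ minus
  rung-sign i rewrite splitAt-↑ˡ m i k = refl

  rung-Joins : ∀ i {α β} → α ≢ β → Joins (Phi k S) (i ↑ˡ k) (i , α) (i , β)
  rung-Joins i {fzero}      {fzero}      α≢β = ⊥-elim (α≢β refl)
  rung-Joins i {fzero}      {fsuc fzero} _   rewrite splitAt-↑ˡ m i k = inj₁ (refl , refl)
  rung-Joins i {fsuc fzero} {fzero}      _   rewrite splitAt-↑ˡ m i k = inj₂ (refl , refl)
  rung-Joins i {fsuc fzero} {fsuc fzero} α≢β = ⊥-elim (α≢β refl)

fin2-cover : ∀ {a b : Fin 2} → a ≢ b → ∀ α → α ≡ a ⊎ α ≡ b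
fin2-cover {fzero}      {fzero}      a≢b _            = ⊥-elim (a≢b refl)
fin2-cover {fzero}      {fsuc fzero} _   fzero        = inj₁ refl
fin2-cover {fzero}      {fsuc fzero} _   (fsuc fzero) = inj₂ refl
fin2-cover {fsuc fzero} {fzero}      _   fzero        = inj₂ refl
fin2-cover {fsuc fzero} {fzero}      _   (fsuc fzero) = inj₁ refl
fin2-cover {fsuc fzero} {fsuc fzero} a≢b _            = ⊥-elim (a≢b refl)

module _ {n m : ℕ} (Sg : SignedGraph (Fin n)) {comp : Fin n → Fin m} {side : Fin n → Fin 2}
         (labelling : IsComponentLabelling Sg comp)
         (sides-differ : ∀ e → sgn Sg e ≡ minus → side (src Sg e) ≢ side (tgt Sg e)) where

  negEdge-sameComp : ∀ e → sgn Sg e ≡ minus → comp (src Sg e) ≡ comp (tgt Sg e)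
  negEdge-sameComp e neg =
    Equivalence.from (proj₂ labelling (src Sg e) (tgt Sg e) (e , neg , inj₁ refl) (e , neg , inj₂ refl))
      (step e (inj₁ (refl , refl)) [] , neg ∷ [])

  negEdge-ends-comp : ∀ {e v} → sgn Sg e ≡ minus → (src Sg e ≡ v ⊎ tgt Sg e ≡ v) →
                 comp (src Sg e) ≡ comp v × comp (tgt Sg e) ≡ comp v
  negEdge-ends-comp {e} neg (inj₁ refl) = refl , sym (negEdge-sameComp e neg)
  negEdge-ends-comp {e} neg (inj₂ refl) = negEdge-sameComp e neg , refl

  part-nonempty : ∀ x → ∃ (InPart Sg comp side x)
  part-nonempty (i , α) with proj₁ labelling i
  ... | v , (e , neg , e∋v) , refl with negEdge-ends-comp neg e∋v | fin2-cover (sides-differ e neg) α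
  ...   | comp-src , _ | inj₁ refl = src Sg e , (e , neg , inj₁ refl) , comp-src , refl
  ...   | _ , comp-tgt | inj₂ refl = tgt Sg e , (e , neg , inj₂ refl) , comp-tgt , refl

  module _ {k : ℕ} (S : Fin k → PhiV m × PhiV m) where

    private
      Φ : SignedGraph (PhiV m)
      Φ = Phi k S

    ClassCondition : (Fin n → Bool) → Set
    ClassCondition B = StableBipNeg Sg B ×
      (∀ x y → PosPath Φ x y → SameClass Sg comp side B x y) ×
      (∀ x y → NegPath Φ x y → OppClass Sg comp side B x y)

    switching⇒classes : ∃ (Switching Φ) → ∃ ClassCondition
    switching⇒classes (f , switching) = B , stable , samePos , oppNeg
      where
        B : Fin n → Bool
        B v = isMinus (f (comp v , side v))

        inClass : ∀ x → InClass Sg comp side B x (isMinus (f x))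
        inClass x v (_ , refl , refl) = refl

        sign-of : ∀ {x y} (p : Walk Φ x y) → walkSign Φ p ≡ f x · f y
        sign-of = walkSign-switching Φ {f} switching

        rung-switching : ∀ i {α β} → α ≢ β → f (i , α) · f (i , β) ≡ minus
        rung-switching i α≢β = trans (sym (switching-Joins Φ {f} switching (rung-Joins S i α≢β))) (rung-sign S i)

        stable : StableBipNeg Sg B
        stable e neg B≡ rewrite negEdge-sameComp e neg =
          not-¬ (sym B≡) (isMinus-·≡minus (rung-switching (comp (tgt Sg e)) (sides-differ e neg)))

        samePos : ∀ x y → PosPath Φ x y → SameClass Sg comp side B x y
        samePos x y (p , _ , p+) =
          isMinus (f x) , inClass x ,
          subst (InClass Sg comp side B y) (cong isMinus (sym (·≡plus⇒≡ (trans (sym (sign-of p)) p+)))) (inClass y)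

        oppNeg : ∀ x y → NegPath Φ x y → OppClass Sg comp side B x y
        oppNeg x y (p , _ , p-) =
          isMinus (f x) , inClass x ,
          subst (InClass Sg comp side B y) (isMinus-·≡minus (trans (sym (sign-of p)) p-)) (inClass y)

    classes⇒switching : ∃ ClassCondition → ∃ (Switching Φ)
    classes⇒switching (B , _ , samePos , oppNeg) = f , switching
      where
        f : PhiV m → Sign
        f x = fromBool (B (proj₁ (part-nonempty x)))

        same⇒ : ∀ {x y} → SameClass Sg comp side B x y → f x · f y ≡ plus
        same⇒ {x} {y} (c , x∈c , y∈c)
          rewrite x∈c _ (proj₂ (part-nonempty x)) | y∈c _ (proj₂ (part-nonempty y)) = ·-selfInverse (fromBool c)

        opp⇒ : ∀ {x y} → OppClass Sg comp side B x y → f x · f y ≡ minus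
        opp⇒ {x} {y} (c , x∈c , y∈¬c)
          rewrite x∈c _ (proj₂ (part-nonempty x)) | y∈¬c _ (proj₂ (part-nonempty y)) = fromBool-not c

        signFits : ∀ x y s → (s ≡ plus → SameClass Sg comp side B x y) → (s ≡ minus → OppClass Sg comp side B x y) →
                   s ≡ f x · f y
        signFits x y plus  same _   = sym (same⇒ (same refl))
        signFits x y minus _    opp = sym (opp⇒ (opp refl))

        switching : Switching Φ f
        switching e with PhiV-≟ (src Φ e) (tgt Φ e)
        ... | yes loop = begin
          sgn Φ e                    ≡⟨ Phi-loop-positive S e loop ⟩
          plus                       ≡⟨ ·-selfInverse (f (src Φ e)) ⟨
          f (src Φ e) · f (src Φ e)  ≡⟨ cong (λ z → f (src Φ e) · f z) loop ⟩
          f (src Φ e) · f (tgt Φ e)  ∎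
        ... | no ¬loop = signFits (src Φ e) (tgt Φ e) (sgn Φ e)
                           (λ e+ → samePos _ _ (edge , edge-isPath , trans (·-identityʳ (sgn Φ e)) e+))
                           (λ e- → oppNeg _ _ (edge , edge-isPath , trans (·-identityʳ (sgn Φ e)) e-))
          where
            edge : Walk Φ (src Φ e) (tgt Φ e)
            edge = step e (inj₁ (refl , refl)) []
            edge-isPath : IsPath Φ edge
            edge-isPath = (¬loop ∷ []) ∷ [] ∷ []

lemma5p2 : {n m k : ℕ} (Sg : SignedGraph (Fin n))
           (comp : Fin n → Fin m) (side : Fin n → Fin 2) →
           IsComponentLabelling Sg comp →
           (∀ e → sgn Sg e ≡ Sign.minus → side (src Sg e) ≢ side (tgt Sg e)) →
           (S : Fin k → PhiV m × PhiV m) →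
           Balanced (Phi k S) ⇔
             Σ (Fin n → Bool) (λ B → StableBipNeg Sg B ×
               (∀ x y → PosPath (Phi k S) x y → SameClass Sg comp side B x y) ×
               (∀ x y → NegPath (Phi k S) x y → OppClass Sg comp side B x y))
lemma5p2 {k = k} Sg comp side labelling sides-differ S =
  mk⇔ (switching⇒classes Sg labelling sides-differ S ∘ Equivalence.to switchable)
      (Equivalence.from switchable ∘ classes⇒switching Sg labelling sides-differ S)
  where
    switchable : Balanced (Phi k S) ⇔ ∃ (Switching (Phi k S))
    switchable = balanced⇔switchable (Phi k S) PhiV-≟
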